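{- Let $V$ be a finite set, let $k\ge 0$ be an integer, and let $\mathcal{H}$ be a set of subsets of $V$, each of cardinality $k$. Suppose that for every $X\subseteq V$ with $|X|=k+1$, if $X$ includes a member of $\mathcal{H}$ then $X$ includes at least two members of $\mathcal{H}$. Then there is a partition $P_1,\ldots,P_n$ of $V$ into nonempty sets such that for all distinct $u,v\in V$, exactly one of the following holds: there exists $i\in\{1,\ldots,n\}$ with $u,v\in P_i$; or there exists $B\in\mathcal{H}$ with $u,v\in B$. -}

module Defs where

open import Level using (0ℓ)
open import Data.Nat using (ℕ; suc)
open import Data.Fin using (Fin)
open import Data.Fin.Subset using (Subset; _∈_; _⊆_; ∣_∣; Nonempty)
open import Data.Product using (Σ; ∃; _×_; ∃-syntax)
open import Data.Sum using (_⊎_)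
open import Relation.Nullary using (¬_)
open import Relation.Binary.PropositionalEquality using (_≡_; _≢_)

-- The ground set V is Fin m; a family of subsets is a predicate on Subset m.
Family : ℕ → Set₁
Family m = Subset m → Set

Uniform : {m : ℕ} → ℕ → Family m → Set
Uniform k H = ∀ B → H B → ∣ B ∣ ≡ k

TwoMembersProperty : {m : ℕ} → ℕ → Family m → Set
TwoMembersProperty {m} k H =
  ∀ (X : Subset m) → ∣ X ∣ ≡ suc k →
  (∃[ B ] (H B × B ⊆ X)) →
  ∃[ B₁ ] ∃[ B₂ ] (B₁ ≢ B₂ × H B₁ × H B₂ × B₁ ⊆ X × B₂ ⊆ X)

IsPartition : {m n : ℕ} → (Fin n → Subset m) → Set
IsPartition {m} {n} P =
  (∀ i → Nonempty (P i)) ×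
  (∀ i j (v : Fin m) → v ∈ P i → v ∈ P j → i ≡ j) ×
  (∀ (v : Fin m) → ∃[ i ] (v ∈ P i))

ExactlyOne : Set → Set → Set
ExactlyOne A B = (A ⊎ B) × ¬ (A × B)

SamePart : {m n : ℕ} → (Fin n → Subset m) → Fin m → Fin m → Set
SamePart P u v = ∃[ i ] (u ∈ P i × v ∈ P i)

CommonMember : {m : ℕ} → Family m → Fin m → Fin m → Set
CommonMember H u v = ∃[ B ] (H B × u ∈ B × v ∈ B)

module Submission where

-- Call distinct vertices u, v /separated/ when no member
-- of H contains both.  The heart of the argument is that "u = v or u, v are
-- separated" is transitive: if u ≠ w lie in a common member B while v is
-- separated from both, then the (k+1)-set B ∪ {v} contains B, hence a second
-- member B'; B' must contain v (otherwise B' ⊆ B and |B'| = |B| force B' = B),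
-- so B' avoids u and w, and then B' ∪ {u} is a (k+1)-subset of B ∪ {v} that
-- misses w, which is impossible by counting.  Hence this relation is a
-- decidable equivalence relation on V, and the partition of V into its
-- classes is the required one: two distinct vertices share a class exactly
-- when they share no member of H.

open import Defs
open import Level using (0ℓ)
open import Data.Nat using (ℕ; suc; _≤_; s≤s)
open import Data.Nat.Properties using (≤-reflexive; <⇒≱)
open import Data.Fin using (Fin; Fin′; zero; suc; inject; compare; less; equal; greater; _≟_)
open import Data.Fin.Properties using (all?; ¬∀⟶∃¬-smallest)
open import Data.Fin.Subset using (Subset; _∈_; _∉_; _⊆_; ∣_∣; _∪_; ⁅_⁆; inside; outside)
open import Data.Fin.Subset.Properties
  using (_∈?_; anySubset?; drop-∷-⊆; p⊆q⇒∣p∣≤∣q∣; ∪-identityʳ; p⊆p∪q; x∈p∪q⁻; x∈⁅y⁆⇒x≡y)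
open import Data.Vec using ([]; _∷_; here; there; tabulate)
open import Data.Vec.Properties using (lookup∘tabulate; lookup⇒[]=; []=⇒lookup)
open import Data.List using (List; filter; allFin; length; lookup)
open import Data.List.Relation.Unary.All as All using ()
open import Data.List.Relation.Unary.AllPairs using (_∷_)
open import Data.List.Relation.Unary.Any using (index)
open import Data.List.Relation.Unary.Any.Properties using (lookup-index)
open import Data.List.Relation.Unary.Unique.Propositional using (Unique)
import Data.List.Relation.Unary.Unique.Propositional.Properties as Unique
open import Data.List.Membership.Propositional using () renaming (_∈_ to _∈ₗ_)
open import Data.List.Membership.Propositional.Properties using (∈-filter⁺; ∈-filter⁻; ∈-allFin; ∈-lookup)
open import Data.Product using (Σ; _×_; ∃-syntax; _,_; proj₂; uncurry)
open import Data.Sum using (_⊎_; inj₁; inj₂)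
open import Function using (_∘_; case_of_; _⇔_; mk⇔; Equivalence)
open import Function.Construct.Composition using (_⇔-∘_)
open import Relation.Unary using (Pred; Decidable)
open import Relation.Binary using (Rel; IsEquivalence) renaming (Decidable to Decidable₂)
open import Relation.Nullary using (¬_; Dec; yes; no; does; ¬?; contradiction)
open import Relation.Nullary.Decidable using (dec-true; decidable-stable; _×-dec_; _⊎-dec_)
open import Relation.Binary.PropositionalEquality using (_≡_; _≢_; refl; sym; trans; cong; subst)

private
  variable
    m : ℕ

⊆-card-≡ : {p q : Subset m} → p ⊆ q → ∣ q ∣ ≤ ∣ p ∣ → p ≡ q
⊆-card-≡ {p = []}          {[]}          _   _         = refl
⊆-card-≡ {p = outside ∷ p} {outside ∷ q} p⊆q c         = cong (outside ∷_) (⊆-card-≡ (drop-∷-⊆ p⊆q) c)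
⊆-card-≡ {p = inside ∷ p}  {inside ∷ q}  p⊆q (s≤s c)   = cong (inside ∷_) (⊆-card-≡ (drop-∷-⊆ p⊆q) c)
⊆-card-≡ {p = inside ∷ p}  {outside ∷ q} p⊆q _         with () ← p⊆q here
⊆-card-≡ {p = outside ∷ p} {inside ∷ q}  p⊆q ∣q∣<∣p∣   =
  contradiction (p⊆q⇒∣p∣≤∣q∣ (drop-∷-⊆ p⊆q)) (<⇒≱ ∣q∣<∣p∣)

∣p∪⁅x⁆∣≡1+∣p∣ : (p : Subset m) (x : Fin m) → x ∉ p → ∣ p ∪ ⁅ x ⁆ ∣ ≡ suc ∣ p ∣
∣p∪⁅x⁆∣≡1+∣p∣ (outside ∷ p) zero    x∉p = cong (suc ∘ ∣_∣) (∪-identityʳ p)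
∣p∪⁅x⁆∣≡1+∣p∣ (inside ∷ p)  zero    x∉p = contradiction here x∉p
∣p∪⁅x⁆∣≡1+∣p∣ (outside ∷ p) (suc x) x∉p = ∣p∪⁅x⁆∣≡1+∣p∣ p x (x∉p ∘ there)
∣p∪⁅x⁆∣≡1+∣p∣ (inside ∷ p)  (suc x) x∉p = cong suc (∣p∪⁅x⁆∣≡1+∣p∣ p x (x∉p ∘ there))

∈p∪⁅x⁆⁻ : {p : Subset m} {x y : Fin m} → y ∈ p ∪ ⁅ x ⁆ → y ∈ p ⊎ y ≡ x
∈p∪⁅x⁆⁻ {p = p} {x} y∈ with x∈p∪q⁻ p ⁅ x ⁆ y∈
... | inj₁ y∈p = inj₁ y∈p
... | inj₂ y∈x = inj₂ (x∈⁅y⁆⇒x≡y x y∈x)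

⟦_⟧ : {Q : Pred (Fin m) 0ℓ} → Decidable Q → Subset m
⟦ Q? ⟧ = tabulate (does ∘ Q?)

∈⟦⟧⁺ : {Q : Pred (Fin m) 0ℓ} (Q? : Decidable Q) {x : Fin m} → Q x → x ∈ ⟦ Q? ⟧
∈⟦⟧⁺ Q? {x} q = lookup⇒[]= x _ (trans (lookup∘tabulate _ x) (dec-true (Q? x) q))

∈⟦⟧⁻ : {Q : Pred (Fin m) 0ℓ} (Q? : Decidable Q) {x : Fin m} → x ∈ ⟦ Q? ⟧ → Q x
∈⟦⟧⁻ Q? {x} x∈ with Q? x | trans (sym (lookup∘tabulate _ x)) ([]=⇒lookup x∈)
... | yes q | _ = q
... | no _  | ()

lookup-injective : {A : Set} {xs : List A} → Unique xs →
                   ∀ i j → lookup xs i ≡ lookup xs j → i ≡ j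
lookup-injective (_ ∷ _)         zero    zero    _  = refl
lookup-injective (x≢xs ∷ _)      zero    (suc j) eq = contradiction eq (All.lookup x≢xs (∈-lookup j))
lookup-injective (x≢xs ∷ _)      (suc i) zero    eq = contradiction (sym eq) (All.lookup x≢xs (∈-lookup i))
lookup-injective (_ ∷ unique)    (suc i) (suc j) eq = cong suc (lookup-injective unique i j eq)

-- The parts are the classes of the least elements of classes.
module ClassPartition {R : Rel (Fin m) 0ℓ} (R? : Decidable₂ R) (R-equiv : IsEquivalence R) where
  open IsEquivalence R-equiv renaming (refl to R-refl; sym to R-sym; trans to R-trans)

  Least : Pred (Fin m) 0ℓ
  Least u = (j : Fin′ u) → ¬ R (inject j) u

  least? : Decidable Least
  least? u = all? (λ j → ¬? (R? (inject j) u))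

  leastInClass : ∀ v → ∃[ u ] (R u v × Least u)
  leastInClass v with ¬∀⟶∃¬-smallest m (λ u → ¬ R u v) (λ u → ¬? (R? u v)) (λ ∀¬R → ∀¬R v R-refl)
  ... | u , ¬¬Ruv , noneBelow = u , Ruv , λ j Rju → noneBelow j (R-trans Rju Ruv)
    where
    Ruv : R u v
    Ruv = decidable-stable (R? u v) ¬¬Ruv

  least-unique : ∀ {u u′} → R u u′ → Least u → Least u′ → u ≡ u′
  least-unique {u} {u′} Ruu′ least-u least-u′ with compare u u′
  ... | less _ j    = contradiction Ruu′ (least-u′ j)
  ... | equal _     = refl
  ... | greater _ j = contradiction (R-sym Ruu′) (least-u j)

  representatives : List (Fin m)
  representatives = filter least? (allFin m)

  n : ℕ
  n = length representatives

  rep : Fin n → Fin m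
  rep = lookup representatives

  part : Fin n → Subset m
  part i = ⟦ R? (rep i) ⟧

  rep-least : ∀ i → Least (rep i)
  rep-least i = proj₂ (∈-filter⁻ least? {xs = allFin m} (∈-lookup i))

  rep-injective : ∀ i j → rep i ≡ rep j → i ≡ j
  rep-injective = lookup-injective (Unique.filter⁺ least? (Unique.allFin⁺ m))

  represented : ∀ v → ∃[ i ] R (rep i) v
  represented v with leastInClass v
  ... | u , Ruv , least-u = index u∈reps , subst (λ w → R w v) (lookup-index u∈reps) Ruv
    where
    u∈reps : u ∈ₗ representatives
    u∈reps = ∈-filter⁺ least? (∈-allFin u) least-u

  isPartition : IsPartition part
  isPartition = (λ i → rep i , ∈⟦⟧⁺ (R? (rep i)) R-refl)
              , (λ i j v v∈i v∈j → rep-injective i j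
                   (least-unique (R-trans (∈⟦⟧⁻ (R? (rep i)) v∈i) (R-sym (∈⟦⟧⁻ (R? (rep j)) v∈j)))
                                 (rep-least i) (rep-least j)))
              , (λ v → let i , Riv = represented v in i , ∈⟦⟧⁺ (R? (rep i)) Riv)

  samePart⇔R : ∀ u v → SamePart part u v ⇔ R u v
  samePart⇔R u v = mk⇔
    (λ (i , u∈i , v∈i) → R-trans (R-sym (∈⟦⟧⁻ (R? (rep i)) u∈i)) (∈⟦⟧⁻ (R? (rep i)) v∈i))
    (λ Ruv → let i , Riu = represented u in
             i , ∈⟦⟧⁺ (R? (rep i)) Riu , ∈⟦⟧⁺ (R? (rep i)) (R-trans Riu Ruv))

classPartition : {R : Rel (Fin m) 0ℓ} → Decidable₂ R → IsEquivalence R →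
                 ∃[ n ] Σ (Fin n → Subset m) (λ P → IsPartition P × (∀ u v → SamePart P u v ⇔ R u v))
classPartition R? R-equiv = n , part , isPartition , samePart⇔R
  where open ClassPartition R? R-equiv

exactlyOne-complement : {A C : Set} → A ⇔ (¬ C) → Dec C → ExactlyOne A C
exactlyOne-complement A⇔¬C (yes c)  = inj₂ c , uncurry (Equivalence.to A⇔¬C)
exactlyOne-complement A⇔¬C (no ¬c) = inj₁ (Equivalence.from A⇔¬C ¬c) , uncurry (Equivalence.to A⇔¬C)

module Separation {k : ℕ} (H : Family m) (H? : Decidable H)
                  (uniform : Uniform k H) (twoMembers : TwoMembersProperty k H) where

  Separated : Rel (Fin m) 0ℓ
  Separated u v = ¬ CommonMember H u v

  commonMember? : Decidable₂ (CommonMember H)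
  commonMember? u v = anySubset? (λ B → H? B ×-dec (u ∈? B ×-dec v ∈? B))

  ∣B∪⁅v⁆∣≡1+k : ∀ {B v} → H B → v ∉ B → ∣ B ∪ ⁅ v ⁆ ∣ ≡ suc k
  ∣B∪⁅v⁆∣≡1+k {B} {v} hB v∉B = trans (∣p∪⁅x⁆∣≡1+∣p∣ B v v∉B) (cong suc (uniform B hB))

  avoiding⇒≡ : ∀ {B B′ v} → H B → H B′ → B′ ⊆ B ∪ ⁅ v ⁆ → v ∉ B′ → B′ ≡ B
  avoiding⇒≡ {B} {B′} hB hB′ B′⊆X v∉B′ =
    ⊆-card-≡ B′⊆B (≤-reflexive (trans (uniform B hB) (sym (uniform B′ hB′))))
    where
    B′⊆B : B′ ⊆ B
    B′⊆B x∈B′ with ∈p∪⁅x⁆⁻ (B′⊆X x∈B′)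
    ... | inj₁ x∈B = x∈B
    ... | inj₂ refl = contradiction x∈B′ v∉B′

  memberThrough : ∀ {B v} → H B → v ∉ B → ∃[ B′ ] (H B′ × B′ ⊆ B ∪ ⁅ v ⁆ × v ∈ B′)
  memberThrough {B} {v} hB v∉B
    with twoMembers (B ∪ ⁅ v ⁆) (∣B∪⁅v⁆∣≡1+k hB v∉B) (B , hB , p⊆p∪q ⁅ v ⁆)
  ... | B₁ , B₂ , B₁≢B₂ , h₁ , h₂ , B₁⊆X , B₂⊆X with v ∈? B₁ | v ∈? B₂
  ... | yes v∈B₁ | _        = B₁ , h₁ , B₁⊆X , v∈B₁
  ... | no _     | yes v∈B₂ = B₂ , h₂ , B₂⊆X , v∈B₂
  ... | no v∉B₁  | no v∉B₂  =
    contradiction (trans (avoiding⇒≡ hB h₁ B₁⊆X v∉B₁) (sym (avoiding⇒≡ hB h₂ B₂⊆X v∉B₂))) B₁≢B₂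

  oneOutside : ∀ {B X u w} → H B → B ⊆ X → ∣ X ∣ ≡ suc k →
               u ∈ X → u ∉ B → w ∈ X → w ∉ B → w ≡ u
  oneOutside {B} {X} {u} {w} hB B⊆X ∣X∣≡1+k u∈X u∉B w∈X w∉B =
    case ∈p∪⁅x⁆⁻ (subst (w ∈_) (sym Y≡X) w∈X) of λ
      { (inj₁ w∈B) → contradiction w∈B w∉B
      ; (inj₂ w≡u) → w≡u }
    where
    Y⊆X : B ∪ ⁅ u ⁆ ⊆ X
    Y⊆X y∈Y with ∈p∪⁅x⁆⁻ y∈Y
    ... | inj₁ y∈B = B⊆X y∈B
    ... | inj₂ refl = u∈X

    Y≡X : B ∪ ⁅ u ⁆ ≡ X
    Y≡X = ⊆-card-≡ Y⊆X (≤-reflexive (trans ∣X∣≡1+k (sym (∣B∪⁅v⁆∣≡1+k hB u∉B))))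

  -- Key lemma: if u ≠ w share a member B and v is separated from both, then
  -- the member of B ∪ {v} through v misses both u and w, which is too many.
  separated-trans : ∀ {u v w} → u ≢ w → Separated u v → Separated v w → Separated u w
  separated-trans {u} {v} {w} u≢w sep-uv sep-vw (B , hB , u∈B , w∈B)
    = case memberThrough hB v∉B of λ (B′ , hB′ , B′⊆X , v∈B′) →
        u≢w (sym (oneOutside hB′ B′⊆X (∣B∪⁅v⁆∣≡1+k hB v∉B)
                    (p⊆p∪q ⁅ v ⁆ u∈B) (λ u∈B′ → sep-uv (B′ , hB′ , u∈B′ , v∈B′))
                    (p⊆p∪q ⁅ v ⁆ w∈B) (λ w∈B′ → sep-vw (B′ , hB′ , v∈B′ , w∈B′))))
    where
    v∉B : v ∉ B
    v∉B v∈B = sep-uv (B , hB , u∈B , v∈B)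

  _≈_ : Rel (Fin m) 0ℓ
  u ≈ v = u ≡ v ⊎ Separated u v

  _≈?_ : Decidable₂ _≈_
  u ≈? v = (u ≟ v) ⊎-dec ¬? (commonMember? u v)

  ≈-isEquivalence : IsEquivalence _≈_
  ≈-isEquivalence = record { refl = inj₁ refl ; sym = ≈-sym ; trans = ≈-trans }
    where
    ≈-sym : ∀ {u v} → u ≈ v → v ≈ u
    ≈-sym (inj₁ u≡v)   = inj₁ (sym u≡v)
    ≈-sym (inj₂ sep-uv) = inj₂ (λ (B , hB , v∈B , u∈B) → sep-uv (B , hB , u∈B , v∈B))

    ≈-trans : ∀ {u v w} → u ≈ v → v ≈ w → u ≈ w
    ≈-trans (inj₁ refl) v≈w = v≈w
    ≈-trans u≈v (inj₁ refl) = u≈v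
    ≈-trans {u} {w = w} (inj₂ sep-uv) (inj₂ sep-vw) with u ≟ w
    ... | yes u≡w = inj₁ u≡w
    ... | no u≢w  = inj₂ (separated-trans u≢w sep-uv sep-vw)

  ≈⇔separated : ∀ {u v} → u ≢ v → (u ≈ v) ⇔ Separated u v
  ≈⇔separated u≢v = mk⇔ (λ { (inj₁ u≡v) → contradiction u≡v u≢v ; (inj₂ sep) → sep }) inj₂

mainTheorem9 : (m k : ℕ) (H : Family m) → Decidable H →
    Uniform k H → TwoMembersProperty k H →
    ∃[ n ] Σ (Fin n → Subset m) (λ P → IsPartition P ×
    (∀ (u v : Fin m) → u ≢ v → ExactlyOne (SamePart P u v) (CommonMember H u v)))
mainTheorem9 m k H H? uniform twoMembers =
  let open Separation H H? uniform twoMembers in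
  case classPartition _≈?_ ≈-isEquivalence of λ (n , P , isPartition , samePart⇔≈) →
    n , P , isPartition , λ u v u≢v →
      exactlyOne-complement (≈⇔separated u≢v ⇔-∘ samePart⇔≈ u v) (commonMember? u v)
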